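{- Let $k\ge 1$ be an integer and let $P=v_1,v_2,\dots,v_{2k}$ be a path. Let $f\colon V(P)\to\mathbb{N}_+$ be a function such that $p:=f(v_1)\le f(v_i)$ for every $i\in\{1,\dots,2k\}$, and $q:=f(v_{2k})\le f(v_j)$ for every even $j\in\{2,\dots,2k\}$. Let $G$ be an $f$-inflation of $P$, with $B_i$ the clique replacing $v_i$. Then $G$ contains an immersion of the complete graph $K_{p+q}$ whose set of branch vertices is exactly $B_1\cup B_{2k}$.
   Context: $\mathbb{N}_+$ denotes the positive integers. For a graph $F$ with vertices $v_1,\dots,v_k$ and $f\colon V(F)\to\mathbb{N}_+$, an $f$-inflation of $F$ is the graph obtained by replacing each $v_i$ by a clique on a vertex set $B_i$ with $|B_i|=f(v_i)$, the $B_i$ pairwise disjoint, and joining $x\in B_i$ to $y\in B_j$ ($i\ne j$) if and only if $v_iv_j\in E(F)$. A graph $G$ contains a graph $K$ as an immersion if there is an injective map $\phi\colon V(K)\to V(G)$ such that for every edge $uv\in E(K)$ there is a path $P_{uv}$ in $G$ with endpoints $\phi(u),\phi(v)$, the paths $P_{uv}$ are pairwise edge-disjoint, and no vertex of $\phi(V(K))$ (the branch vertices) is an interior vertex of any path $P_{uv}$. -}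

module Defs where

open import Data.Nat using (ℕ; zero; suc; _+_; _*_; _≤_; _<_; z≤n; s≤s)
open import Data.Fin using (Fin; toℕ; fromℕ) renaming (zero to fzero)
open import Data.Product using (Σ; _×_; _,_; proj₁; proj₂)
open import Data.Sum using (_⊎_)
open import Data.List using (List; []; _∷_; _++_)
open import Data.List.Membership.Propositional using (_∈_; _∉_)
open import Data.List.Relation.Unary.All using (All)
open import Data.List.Relation.Unary.Unique.Propositional using (Unique)
open import Relation.Binary.PropositionalEquality using (_≡_; _≢_)
open import Data.Fin renaming (_<_ to _Fin<_) using ()
open import Relation.Nullary using (¬_)

consecutive : {V : Set} → List V → List (V × V)
consecutive (x ∷ y ∷ r) = (x , y) ∷ consecutive (y ∷ r)
consecutive _ = []

IsPath : {V : Set} (E : V → V → Set) → List V → Set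
IsPath E ws = All (λ e → E (proj₁ e) (proj₂ e)) (consecutive ws) × Unique ws

SameEdge : {V : Set} → V × V → V × V → Set
SameEdge (x , y) (x' , y') = (x ≡ x' × y ≡ y') ⊎ (x ≡ y' × y ≡ x')

-- An immersion of the complete graph K_m: injective branch map φ, and for
-- every edge {a,b} of K_m (a < b) a path from φ a to φ b, given by its list
-- of interior vertices; paths pairwise edge-disjoint; no branch vertex is an
-- interior vertex of any path.
record KImmersion {V : Set} (E : V → V → Set) (m : ℕ) : Set where
  field
    φ : Fin m → V
    φ-injective : ∀ a b → φ a ≡ φ b → a ≡ b
    interior : (a b : Fin m) → a Fin< b → List V
  route : (a b : Fin m) → a Fin< b → List V
  route a b h = φ a ∷ (interior a b h ++ (φ b ∷ []))
  field
    route-path : ∀ a b (h : a Fin< b) → IsPath E (route a b h)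
    branch-not-interior : ∀ a b (h : a Fin< b) c → φ c ∉ interior a b h
    edge-disjoint : ∀ a b (h : a Fin< b) a' b' (h' : a' Fin< b') →
      ¬ (a ≡ a' × b ≡ b') →
      ∀ e e' → e ∈ consecutive (route a b h) → e' ∈ consecutive (route a' b' h') →
      ¬ SameEdge e e'

-- The path P = v_1 … v_n, vertices indexed (0-based) by Fin n.

PathAdj : {n : ℕ} → Fin n → Fin n → Set
PathAdj i j = toℕ j ≡ suc (toℕ i) ⊎ toℕ i ≡ suc (toℕ j)

-- f-inflation of P: blocks B_i = {i} × Fin (f i), each a clique, and
-- x ∈ B_i, y ∈ B_j (i ≠ j) adjacent iff v_i v_j ∈ E(P).
InflVertex : {n : ℕ} → (Fin n → ℕ) → Set
InflVertex {n} f = Σ (Fin n) (λ i → Fin (f i))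

InflAdj : {n : ℕ} (f : Fin n → ℕ) → InflVertex f → InflVertex f → Set
InflAdj f x y = (proj₁ x ≡ proj₁ y × x ≢ y) ⊎ PathAdj (proj₁ x) (proj₁ y)

-- index of v_1 and of v_{2k} in Fin (2 * k), for k ≥ 1
firstIx : (k : ℕ) → 1 ≤ k → Fin (2 * k)
firstIx (suc k) _ = fzero

lastIx : (k : ℕ) → 1 ≤ k → Fin (2 * k)
lastIx (suc k) _ = fromℕ (k + suc (k + 0))

-- Two branch vertices in the same
-- block are joined by their clique edge.  The x-th vertex of B₁ is joined to the y-th
-- vertex of B_{2k} by the path through B₁, B₂, …, B_{2k} taking alternately the x-th and
-- the y-th vertex of each block; these exist because p is the least block size and q the
-- least size of an even-indexed block.  Such a path only uses edges between consecutive
-- blocks, and each of them has one end labelled x and the other labelled y, so it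
-- determines the pair (x, y): the paths are edge-disjoint.
module Submission where

open import Defs
open import Data.Nat using (ℕ; zero; suc; _+_; _*_; _≤_; _<_; _%_; _≟_)
open import Data.Nat.Properties using (<-irrefl; <-asym; ≤-refl; ≤-<-trans; m≤m+n; +-cancelˡ-<; +-suc; *-comm)
open import Data.Nat.DivMod using (%-remove-+ˡ; [m+kn]%n≡m%n)
open import Data.Nat.Divisibility using (∣-refl)
open import Data.Fin using (Fin; toℕ; fromℕ; inject₁; inject≤; splitAt; join; _↑ˡ_; _↑ʳ_) renaming (zero to fzero; suc to fsuc)
import Data.Fin as Fin
open import Data.Fin.Properties using (toℕ-injective; toℕ-fromℕ; toℕ-inject₁; toℕ-inject≤; inject₁-injective; fromℕ≢inject₁; ≤̄⇒inject₁<; toℕ<n; toℕ-↑ˡ; toℕ-↑ʳ; splitAt-↑ˡ; splitAt-↑ʳ; join-splitAt) renaming (suc-injective to fsuc-injective)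
open import Data.Product using (Σ; ∃-syntax; _×_; _,_; proj₁; proj₂)
open import Data.Sum using (_⊎_; inj₁; inj₂)
open import Data.Sum.Relation.Binary.LeftOrder using (_⊎-<_; ₁∼₂; ₁∼₁; ₂∼₂)
open import Data.Empty using (⊥-elim)
open import Data.List using (List; []; _∷_; _++_; _∷ʳ_; tabulate)
open import Data.List.Relation.Unary.All as All using ([]; _∷_)
open import Data.List.Relation.Unary.Any using (here; there)
open import Data.List.Relation.Unary.AllPairs using ([]; _∷_)
open import Data.List.Membership.Propositional using (_∈_; _∉_)
open import Data.List.Membership.Propositional.Properties using (∈-tabulate⁻)
open import Data.List.Relation.Unary.Unique.Propositional using (Unique)
open import Data.List.Relation.Unary.Unique.Propositional.Properties using (tabulate⁺)
open import Function using (_∘_)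
open import Function.Bundles using (_⇔_; mk⇔)
open import Relation.Nullary using (¬_; yes; no)
open import Relation.Unary using (Decidable)
open import Relation.Binary.PropositionalEquality using (_≡_; _≢_; refl; sym; trans; cong; cong₂; subst; subst₂; module ≡-Reasoning)

Odd : ℕ → Set
Odd n = n % 2 ≡ 1

odd? : Decidable Odd
odd? n = n % 2 ≟ 1

%2-suc-suc : ∀ n → suc (suc n) % 2 ≡ n % 2
%2-suc-suc n = %-remove-+ˡ n ∣-refl

¬odd⇒odd-suc : ∀ n → ¬ Odd n → Odd (suc n)
¬odd⇒odd-suc zero _ = refl
¬odd⇒odd-suc (suc zero) ¬odd = ⊥-elim (¬odd refl)
¬odd⇒odd-suc (suc (suc n)) ¬odd =
  trans (%2-suc-suc (suc n)) (¬odd⇒odd-suc n (¬odd ∘ trans (%2-suc-suc n)))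

odd⇒¬odd-suc : ∀ n → Odd n → ¬ Odd (suc n)
odd⇒¬odd-suc (suc zero) _ ()
odd⇒¬odd-suc (suc (suc n)) odd odd-suc =
  odd⇒¬odd-suc n (trans (sym (%2-suc-suc n)) odd) (trans (sym (%2-suc-suc (suc n))) odd-suc)

k+[1+k]-odd : ∀ k → Odd (k + suc (k + 0))
k+[1+k]-odd k =
  trans (cong (_% 2) (trans (+-suc k (k + 0)) (cong suc (*-comm 2 k)))) ([m+kn]%n≡m%n 1 k 2)

tabulate-∷ʳ : ∀ {A : Set} n (h : Fin (suc n) → A) → tabulate h ≡ tabulate (h ∘ inject₁) ∷ʳ h (fromℕ n)
tabulate-∷ʳ zero h = refl
tabulate-∷ʳ (suc n) h = cong (h fzero ∷_) (tabulate-∷ʳ n (h ∘ fsuc))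

∈-consecutive-tabulate⁻ : ∀ {A : Set} {n} (h : Fin (suc n) → A) {e} → e ∈ consecutive (tabulate h) →
  ∃[ i ] e ≡ (h (inject₁ i) , h (fsuc i))
∈-consecutive-tabulate⁻ {n = suc n} h (here refl) = fzero , refl
∈-consecutive-tabulate⁻ {n = suc n} h (there mem) with ∈-consecutive-tabulate⁻ (h ∘ fsuc) mem
... | i , refl = fsuc i , refl

inject₁<suc : ∀ {n} (i : Fin n) → toℕ (inject₁ i) < toℕ (fsuc i)
inject₁<suc i = ≤̄⇒inject₁< ≤-refl

SameEdge-sym : ∀ {V : Set} {e e' : V × V} → SameEdge e e' → SameEdge e' e
SameEdge-sym (inj₁ (refl , refl)) = inj₁ (refl , refl)
SameEdge-sym (inj₂ (refl , refl)) = inj₂ (refl , refl)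

module _ {V : Set} (key : V → ℕ) where

  sameEdge-ascending : ∀ {u v u' v'} → key u < key v → key u' < key v' →
    SameEdge (u , v) (u' , v') → u ≡ u' × v ≡ v'
  sameEdge-ascending _ _ (inj₁ aligned) = aligned
  sameEdge-ascending u<v u'<v' (inj₂ (refl , refl)) = ⊥-elim (<-asym u<v u'<v')

  sameEdge-flat-ascending : ∀ {u v u' v'} → key u ≡ key v → key u' < key v' →
    ¬ SameEdge (u , v) (u' , v')
  sameEdge-flat-ascending flat u'<v' (inj₁ (refl , refl)) = <-irrefl flat u'<v'
  sameEdge-flat-ascending flat u'<v' (inj₂ (refl , refl)) = <-irrefl (sym flat) u'<v'

EndBlocksImmersion : ∀ {m} (f : Fin (suc m) → ℕ) → Set
EndBlocksImmersion {m} f =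
  Σ (KImmersion (InflAdj f) (f fzero + f (fromℕ m)))
    (λ I → ∀ (x : InflVertex f) →
      (Σ (Fin (f fzero + f (fromℕ m))) (λ c → KImmersion.φ I c ≡ x))
        ⇔ (proj₁ x ≡ fzero ⊎ proj₁ x ≡ fromℕ m))

-- Blocks are indexed from 0, so odd indices are the paper's even-indexed blocks.
module EndBlocks (n : ℕ) (f : Fin (suc (suc n)) → ℕ) (last-odd : Odd (suc n))
  (first-least : ∀ i → f fzero ≤ f i)
  (last-least-odd : ∀ j → Odd (toℕ j) → f (fromℕ (suc n)) ≤ f j) where

  V : Set
  V = InflVertex f

  first last : Fin (suc (suc n))
  first = fzero
  last = fromℕ (suc n)

  p q : ℕ
  p = f first
  q = f last

  level label : V → ℕ
  level = toℕ ∘ proj₁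
  label = toℕ ∘ proj₂

  Branch : Set
  Branch = Fin p ⊎ Fin q

  branch : Branch → V
  branch (inj₁ x) = first , x
  branch (inj₂ y) = last , y

  branch-injective : ∀ s t → branch s ≡ branch t → s ≡ t
  branch-injective (inj₁ x) (inj₁ y) eq = cong inj₁ (toℕ-injective (cong label eq))
  branch-injective (inj₂ x) (inj₂ y) eq = cong inj₂ (toℕ-injective (cong label eq))
  branch-injective (inj₁ x) (inj₂ y) eq with cong proj₁ eq
  ... | ()
  branch-injective (inj₂ x) (inj₁ y) eq with cong proj₁ eq
  ... | ()

  zigzag-label : Fin p → Fin q → (j : Fin (suc (suc n))) → Fin (f j)
  zigzag-label x y j with odd? (toℕ j)
  ... | yes odd = inject≤ y (last-least-odd j odd)
  ... | no _ = inject≤ x (first-least j)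

  zigzag : Fin p → Fin q → Fin (suc (suc n)) → V
  zigzag x y j = j , zigzag-label x y j

  label-zigzag-odd : ∀ {x y} j → Odd (toℕ j) → label (zigzag x y j) ≡ toℕ y
  label-zigzag-odd j odd with odd? (toℕ j)
  ... | yes _ = toℕ-inject≤ _ _
  ... | no ¬odd = ⊥-elim (¬odd odd)

  label-zigzag-even : ∀ {x y} j → ¬ Odd (toℕ j) → label (zigzag x y j) ≡ toℕ x
  label-zigzag-even j ¬odd with odd? (toℕ j)
  ... | yes odd = ⊥-elim (¬odd odd)
  ... | no _ = toℕ-inject≤ _ _

  zigzag-first : ∀ x y → zigzag x y first ≡ branch (inj₁ x)
  zigzag-first x y = cong (first ,_) (toℕ-injective (label-zigzag-even {y = y} first (λ ())))

  zigzag-last : ∀ x y → zigzag x y last ≡ branch (inj₂ y)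
  zigzag-last x y =
    cong (last ,_) (toℕ-injective (label-zigzag-odd last (subst Odd (sym (toℕ-fromℕ (suc n))) last-odd)))

  zigzag-odd-injective : ∀ {x y x' y'} j → Odd (toℕ j) → zigzag x y j ≡ zigzag x' y' j → y ≡ y'
  zigzag-odd-injective j odd eq = toℕ-injective (begin
    toℕ _                 ≡⟨ label-zigzag-odd j odd ⟨
    label (zigzag _ _ j)  ≡⟨ cong label eq ⟩
    label (zigzag _ _ j)  ≡⟨ label-zigzag-odd j odd ⟩
    toℕ _                 ∎)
    where open ≡-Reasoning

  zigzag-even-injective : ∀ {x y x' y'} j → ¬ Odd (toℕ j) → zigzag x y j ≡ zigzag x' y' j → x ≡ x'
  zigzag-even-injective j ¬odd eq = toℕ-injective (begin
    toℕ _                 ≡⟨ label-zigzag-even j ¬odd ⟨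
    label (zigzag _ _ j)  ≡⟨ cong label eq ⟩
    label (zigzag _ _ j)  ≡⟨ label-zigzag-even j ¬odd ⟩
    toℕ _                 ∎)
    where open ≡-Reasoning

  zigzag-step-injective : ∀ {x y x' y'} i →
    zigzag x y (inject₁ i) ≡ zigzag x' y' (inject₁ i) → zigzag x y (fsuc i) ≡ zigzag x' y' (fsuc i) →
    x ≡ x' × y ≡ y'
  zigzag-step-injective i eq eq' with odd? (toℕ i)
  ... | yes odd = zigzag-even-injective (fsuc i) (odd⇒¬odd-suc (toℕ i) odd) eq'
                , zigzag-odd-injective (inject₁ i) (subst Odd (sym (toℕ-inject₁ i)) odd) eq
  ... | no ¬odd = zigzag-even-injective (inject₁ i) (¬odd ∘ subst Odd (toℕ-inject₁ i)) eq
                , zigzag-odd-injective (fsuc i) (¬odd⇒odd-suc (toℕ i) ¬odd) eq'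

  _≺_ : Branch → Branch → Set
  _≺_ = Fin._<_ ⊎-< Fin._<_

  join-<⇒≺ : ∀ s t → join p q s Fin.< join p q t → s ≺ t
  join-<⇒≺ (inj₁ x) (inj₁ y) lt = ₁∼₁ (subst₂ _<_ (toℕ-↑ˡ x q) (toℕ-↑ˡ y q) lt)
  join-<⇒≺ (inj₁ x) (inj₂ y) _ = ₁∼₂
  join-<⇒≺ (inj₂ x) (inj₂ y) lt =
    ₂∼₂ (+-cancelˡ-< p (toℕ x) (toℕ y) (subst₂ _<_ (toℕ-↑ʳ p x) (toℕ-↑ʳ p y) lt))
  join-<⇒≺ (inj₂ x) (inj₁ y) lt =
    ⊥-elim (<-asym (≤-<-trans (m≤m+n p (toℕ x)) (subst₂ _<_ (toℕ-↑ʳ p x) (toℕ-↑ˡ y q) lt)) (toℕ<n y))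

  splitAt-<⇒≺ : ∀ (a b : Fin (p + q)) → a Fin.< b → splitAt p a ≺ splitAt p b
  splitAt-<⇒≺ a b =
    join-<⇒≺ (splitAt p a) (splitAt p b) ∘ subst₂ Fin._<_ (sym (join-splitAt p q a)) (sym (join-splitAt p q b))

  splitAt-injective : ∀ (a b : Fin (p + q)) → splitAt p a ≡ splitAt p b → a ≡ b
  splitAt-injective a b eq = trans (sym (join-splitAt p q a)) (trans (cong (join p q) eq) (join-splitAt p q b))

  interior : Branch → Branch → List V
  interior (inj₁ x) (inj₂ y) = tabulate (zigzag x y ∘ fsuc ∘ inject₁)
  interior _ _ = []

  route : Branch → Branch → List V
  route s t = branch s ∷ interior s t ++ branch t ∷ []

  cross-route : ∀ x y → route (inj₁ x) (inj₂ y) ≡ tabulate (zigzag x y)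
  cross-route x y = begin
    branch (inj₁ x) ∷ inner ∷ʳ branch (inj₂ y)
      ≡⟨ cong₂ (λ u v → u ∷ inner ∷ʳ v) (zigzag-first x y) (zigzag-last x y) ⟨
    zigzag x y first ∷ inner ∷ʳ zigzag x y last
      ≡⟨ cong (zigzag x y first ∷_) (tabulate-∷ʳ n (zigzag x y ∘ fsuc)) ⟨
    tabulate (zigzag x y) ∎
    where
    open ≡-Reasoning
    inner = interior (inj₁ x) (inj₂ y)

  label-<⇒≢ : ∀ {u v} → label u < label v → u ≢ v
  label-<⇒≢ lt eq = <-irrefl (cong label eq) lt

  data RouteEdge : Branch → Branch → V × V → Set where
    clique : ∀ {s t} → proj₁ (branch s) ≡ proj₁ (branch t) → label (branch s) < label (branch t) →
             RouteEdge s t (branch s , branch t)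
    step : ∀ {x y} i → RouteEdge (inj₁ x) (inj₂ y) (zigzag x y (inject₁ i) , zigzag x y (fsuc i))

  route-edge : ∀ {s t e} → s ≺ t → e ∈ consecutive (route s t) → RouteEdge s t e
  route-edge (₁∼₁ x<y) (here refl) = clique refl x<y
  route-edge (₂∼₂ x<y) (here refl) = clique refl x<y
  route-edge {inj₁ x} {inj₂ y} {e} ₁∼₂ mem
    with ∈-consecutive-tabulate⁻ (zigzag x y) (subst (λ r → e ∈ consecutive r) (cross-route x y) mem)
  ... | i , refl = step i
  route-edge (₁∼₁ _) (there ())
  route-edge (₂∼₂ _) (there ())

  routeEdge-adjacent : ∀ {s t e} → RouteEdge s t e → InflAdj f (proj₁ e) (proj₂ e)
  routeEdge-adjacent (clique same-block lt) = inj₁ (same-block , label-<⇒≢ lt)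
  routeEdge-adjacent (step i) = inj₂ (inj₁ (cong suc (sym (toℕ-inject₁ i))))

  route-unique : ∀ {s t} → s ≺ t → Unique (route s t)
  route-unique (₁∼₁ x<y) = (label-<⇒≢ x<y ∷ []) ∷ [] ∷ []
  route-unique (₂∼₂ x<y) = (label-<⇒≢ x<y ∷ []) ∷ [] ∷ []
  route-unique {inj₁ x} {inj₂ y} ₁∼₂ = subst Unique (sym (cross-route x y)) (tabulate⁺ {f = zigzag x y} (cong proj₁))

  route-path : ∀ {s t} → s ≺ t → IsPath (InflAdj f) (route s t)
  route-path s≺t = All.tabulate (routeEdge-adjacent ∘ route-edge s≺t) , route-unique s≺t

  branch-not-inner : ∀ u i → proj₁ (branch u) ≢ fsuc (inject₁ i)
  branch-not-inner (inj₁ _) i ()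
  branch-not-inner (inj₂ _) i eq = fromℕ≢inject₁ (fsuc-injective eq)

  branch-∉-interior : ∀ s t u → branch u ∉ interior s t
  branch-∉-interior (inj₁ x) (inj₂ y) u mem with ∈-tabulate⁻ mem
  ... | i , eq = branch-not-inner u i (cong proj₁ eq)
  branch-∉-interior (inj₁ _) (inj₁ _) _ ()
  branch-∉-interior (inj₂ _) _ _ ()

  routeEdge-unique : ∀ {s t s' t' e e'} → RouteEdge s t e → RouteEdge s' t' e' → SameEdge e e' →
    s ≡ s' × t ≡ t'
  routeEdge-unique (clique _ lt) (clique _ lt') same with sameEdge-ascending label lt lt' same
  ... | eq , eq' = branch-injective _ _ eq , branch-injective _ _ eq'
  routeEdge-unique (clique flat _) (step i) same =
    ⊥-elim (sameEdge-flat-ascending level (cong toℕ flat) (inject₁<suc i) same)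
  routeEdge-unique (step i) (clique flat _) same =
    ⊥-elim (sameEdge-flat-ascending level (cong toℕ flat) (inject₁<suc i) (SameEdge-sym same))
  routeEdge-unique (step i) (step i') same with sameEdge-ascending level (inject₁<suc i) (inject₁<suc i') same
  ... | eq , eq' with inject₁-injective (cong proj₁ eq)
  ...   | refl with zigzag-step-injective i eq eq'
  ...     | refl , refl = refl , refl

  immersion : KImmersion (InflAdj f) (p + q)
  immersion = record
    { φ = branch ∘ splitAt p
    ; φ-injective = λ a b → splitAt-injective a b ∘ branch-injective (splitAt p a) (splitAt p b)
    ; interior = λ a b _ → interior (splitAt p a) (splitAt p b)
    ; route-path = λ a b a<b → route-path (splitAt-<⇒≺ a b a<b)
    ; branch-not-interior = λ a b _ c → branch-∉-interior (splitAt p a) (splitAt p b) (splitAt p c)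
    ; edge-disjoint = λ a b a<b a' b' a'<b' distinct _ _ mem mem' same →
        let (eq , eq') = routeEdge-unique (route-edge (splitAt-<⇒≺ a b a<b) mem)
                                          (route-edge (splitAt-<⇒≺ a' b' a'<b') mem') same
        in distinct (splitAt-injective a a' eq , splitAt-injective b b' eq')
    }

  branch-in-end-block : ∀ s → proj₁ (branch s) ≡ first ⊎ proj₁ (branch s) ≡ last
  branch-in-end-block (inj₁ _) = inj₁ refl
  branch-in-end-block (inj₂ _) = inj₂ refl

  end-block-branch : ∀ (x : V) → proj₁ x ≡ first ⊎ proj₁ x ≡ last → Σ (Fin (p + q)) (λ c → branch (splitAt p c) ≡ x)
  end-block-branch (_ , l) (inj₁ refl) = l ↑ˡ q , cong branch (splitAt-↑ˡ p l q)
  end-block-branch (_ , l) (inj₂ refl) = p ↑ʳ l , cong branch (splitAt-↑ʳ p q l)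

  end-blocks-immersion : EndBlocksImmersion f
  end-blocks-immersion =
    immersion , λ x → mk⇔ (λ { (c , refl) → branch-in-end-block (splitAt p c) }) (end-block-branch x)

odd-path-immersion : ∀ m → Odd m → (f : Fin (suc m) → ℕ) → (∀ i → f fzero ≤ f i) →
  (∀ j → Odd (toℕ j) → f (fromℕ m) ≤ f j) → EndBlocksImmersion f
odd-path-immersion zero ()
odd-path-immersion (suc n) odd f = EndBlocks.end-blocks-immersion n f odd

lemma2p1 : (k : ℕ) (k≥1 : 1 ≤ k) (f : Fin (2 * k) → ℕ) →
    (∀ i → 1 ≤ f i) →
    (∀ i → f (firstIx k k≥1) ≤ f i) →
    (∀ j → toℕ j % 2 ≡ 1 → f (lastIx k k≥1) ≤ f j) →
    Σ (KImmersion (InflAdj f) (f (firstIx k k≥1) + f (lastIx k k≥1)))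
      (λ I → ∀ (x : InflVertex f) →
        (Σ (Fin (f (firstIx k k≥1) + f (lastIx k k≥1))) (λ c → KImmersion.φ I c ≡ x))
          ⇔ (proj₁ x ≡ firstIx k k≥1 ⊎ proj₁ x ≡ lastIx k k≥1))
lemma2p1 (suc k) _ f _ = odd-path-immersion (k + suc (k + 0)) (k+[1+k]-odd k) f
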